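{- For every graph $G$, $$Z(G)\leq \sum_{u\in V(G)}\ \sum_{i=0}^{d_G(u)}(-1)^i\sum_{I\in \binom{N_G(u)}{i}}\left|\{u\}\cup\bigcup_{v\in I}N_G[v]\right|^{ -1}.$$
   Context: All graphs are finite, simple and undirected. $N_G(u)$ is the set of neighbors of $u$, $N_G[v]=N_G(v)\cup\{v\}$ the closed neighborhood, and $d_G(u)=|N_G(u)|$. For a set $N$ and integer $i\geq 0$, $\binom{N}{i}$ denotes the set of all $i$-element subsets of $N$ (for $I=\emptyset$ the union is empty, so the term is $1$). For a set $Z\subseteq V(G)$, let $\mathcal{F}(Z)$ be the set obtained from $Z$ by repeatedly adding a vertex $u$ outside the current set whenever $u$ is the unique neighbor outside the current set of some vertex in the current set, as long as possible. $Z$ is a zero forcing set of $G$ if $\mathcal{F}(Z)=V(G)$. The zero forcing number $Z(G)$ is the minimum cardinality of a zero forcing set of $G$. -}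

module Defs where

open import Data.Bool using (Bool; true; false; _∧_; if_then_else_)
open import Data.Nat as ℕ using (ℕ; zero; suc; _≡ᵇ_)
open import Data.Integer as ℤ using (ℤ; +_)
open import Data.Fin using (Fin)
open import Data.Vec using (Vec; []; _∷_; tabulate; lookup)
open import Data.List as List using (List; []; _∷_; filter; map; allFin; upTo; concatMap)
open import Data.Fin.Subset using (Subset; ⁅_⁆; _∈_; _∪_; _─_; ⋃; ∣_∣; outside; inside) renaming (⊤ to Full)
open import Data.Rational as ℚ using (ℚ; 0ℚ; _/_; _+_)
open import Relation.Binary.PropositionalEquality using (_≡_)
open import Relation.Nullary.Decidable using (⌊_⌋)
open import Relation.Unary using (Decidable)
open import Data.Product using (Σ; _×_; ∃)

record Graph (n : ℕ) : Set where
  field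
    adj    : Fin n → Fin n → Bool
    sym    : ∀ u v → adj u v ≡ adj v u
    irrefl : ∀ u → adj u u ≡ false
open Graph public

module _ {n : ℕ} (G : Graph n) where

  N : Fin n → Subset n
  N u = tabulate (adj G u)

  N[_] : Fin n → Subset n
  N[ v ] = ⁅ v ⁆ ∪ N v

  deg : Fin n → ℕ
  deg u = ∣ N u ∣

  -- Zero forcing: sets obtainable from Z by a sequence of forcing steps.
  -- A step: u ∈ S, and w is the unique neighbour of u outside S
  -- (i.e. N(u) ─ S = {w}); then w is added.
  data Forced (Z : Subset n) : Subset n → Set where
    start : Forced Z Z
    force : ∀ {S} (u w : Fin n) → Forced Z S → u ∈ S →
            N u ─ S ≡ ⁅ w ⁆ → Forced Z (S ∪ ⁅ w ⁆)

  IsZeroForcingSet : Subset n → Set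
  IsZeroForcingSet Z = Forced Z Full

  IsZeroForcingNumber : ℕ → Set
  IsZeroForcingNumber k =
    (Σ (Subset n) λ Z → IsZeroForcingSet Z × ∣ Z ∣ ≡ k) ×
    (∀ Z → IsZeroForcingSet Z → k ℕ.≤ ∣ Z ∣)

subsetsOf : ∀ {n} → Subset n → List (Subset n)
subsetsOf []            = [] ∷ []
subsetsOf (false ∷ p)   = map (outside ∷_) (subsetsOf p)
subsetsOf (true  ∷ p)   = map (outside ∷_) (subsetsOf p) List.++ map (inside ∷_) (subsetsOf p)

binom : ∀ {n} → Subset n → ℕ → List (Subset n)
binom p i = filter (λ I → ℕ._≟_ ∣ I ∣ i) (subsetsOf p)

elements : ∀ {n} → Subset n → List (Fin n)
elements {n} I = filter (λ v → Data.Bool._≟_ (lookup I v) true) (allFin n)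
  where import Data.Bool

Σℚ : ∀ {A : Set} → List A → (A → ℚ) → ℚ
Σℚ xs f = List.foldr (λ x acc → f x + acc) 0ℚ xs

sign : ℕ → ℚ
sign zero    = ℚ.1ℚ
sign (suc i) = ℚ.- sign i

-- reciprocal 1/m of a natural number (only used for m ≥ 1; 1/0 := 0 is never used)
recip : ℕ → ℚ
recip zero    = 0ℚ
recip (suc m) = (+ 1) / suc m

ℕ→ℚ : ℕ → ℚ
ℕ→ℚ k = (+ k) / 1

bound : ∀ {n} → Graph n → ℚ
bound {n} G =
  Σℚ (allFin n) λ u →
    Σℚ (upTo (suc (deg G u))) λ i →
      sign i ℚ.* Σℚ (binom (N G u) i) λ I →
        recip ∣ ⁅ u ⁆ ∪ ⋃ (map (N[_] G) (elements I)) ∣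

module Submission where

-- For an ordering π of the vertices, let Z_π be the set of vertices u such that for no
-- neighbour v of u does u come first in π among N[v]. Z_π is a zero forcing set: add the
-- vertices of π from last to first; a vertex w ∉ Z_π comes first among N[v] for some v ~ w,
-- so v and all of N[v] except w are already present, and v forces w. Hence Z(G) ≤ |Z_π|
-- for every π, so Z(G) is at most the average of |Z_π| over the n! orderings. By
-- inclusion–exclusion over the neighbours of u,
--   [u ∈ Z_π] = Σ_{I ⊆ N(u)} (-1)^|I| [u comes first among {u} ∪ ⋃_{v ∈ I} N[v]],
-- and u comes first among a set S ∋ u in exactly n!/|S| orderings.

open import Algebra.Bundles using (CommutativeRing)
import Algebra.Properties.Semiring.Mult as SemiringMult
open import Data.Bool using (Bool; true; false; _∧_; _∨_; not; if_then_else_; T)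
open import Data.Bool.ListAction using (all)
import Data.Bool.Properties as Bool
open import Data.Bool.Properties using (T-∧)
open import Data.Empty using (⊥-elim)
open import Data.Fin using (Fin; _≟_) renaming (zero to fzero; suc to fsuc)
open import Data.Fin.Subset using (Subset; outside; inside; ∣_∣; ⁅_⁆; _∪_; _─_; ⋃)
  renaming (⊥ to ∅; ⊤ to Full; _∈_ to _∈ₛ_)
open import Data.Fin.Subset.Properties using (∣⁅x⁆∣≡1)
import Data.Integer as ℤ
open import Data.Integer.Tactic.RingSolver renaming (solve-∀ to ℤ-solve-∀)
open import Data.List using (List; []; _∷_; _++_; map; length; allFin; filter; upTo)
open import Data.List.Membership.Propositional using (_∈_; _∉_)
open import Data.List.Membership.Propositional.Properties
  using (∈-map⁻; ∈-++⁻; ∈-filter⁺; ∈-filter⁻; ∈-allFin)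
open import Data.List.Properties using (map-∘; length-map; map-applyUpTo; map-tabulate; length-tabulate)
open import Data.List.Relation.Binary.Permutation.Propositional
  using (_↭_; ↭-refl; ↭-prep; ↭-swap; ↭-trans; ↭⇒↭ₛ)
open import Data.List.Relation.Binary.Permutation.Propositional.Properties using (∈-resp-↭)
import Data.List.Relation.Binary.Permutation.Setoid.Properties as PermutationSetoid
import Data.List.Relation.Unary.All as All
open import Data.List.Relation.Unary.All.Properties using (all⁺; all⁻; All¬⇒¬Any)
open import Data.List.Relation.Unary.Any using (here; there)
open import Data.List.Relation.Unary.Unique.Propositional using (Unique; _∷_; [])
open import Data.List.Relation.Unary.Unique.Propositional.Properties using (allFin⁺)
open import Data.Maybe using (Maybe; just; nothing)
open import Data.Nat as ℕ using (ℕ; zero; suc; NonZero; _!)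
open import Data.Nat.Coprimality as Coprime using (1-coprimeTo)
import Data.Nat.Properties as ℕ
open import Data.Product using (_×_; _,_; proj₁; proj₂; ∃; map₂)
open import Data.Rational using (ℚ; mkℚ; 0ℚ; 1ℚ; _+_; _*_; -_; _-_; _≤_; Positive; nonNegative)
open import Data.Rational.Properties renaming (_≟_ to _≟ℚ_)
import Data.Rational.Unnormalised as ℚᵘ
import Data.Rational.Unnormalised.Properties as ℚᵘ
open import Data.Sum using (_⊎_; inj₁; inj₂)
open import Data.Vec using ([]; _∷_; lookup; tabulate)
open import Data.Vec.Properties
  using (lookup-zipWith; lookup-replicate; lookup∘tabulate; tabulate∘lookup; tabulate-cong; lookup⇒[]=)
open import Function using (Equivalence; _∘_)
open import Relation.Binary.PropositionalEquality
open import Relation.Nullary using (yes; no; does)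
open import Relation.Nullary.Decidable using (dec-true; dec-false)
open import Relation.Unary using (Decidable)
open import Tactic.RingSolver using (solve-∀)
open import Tactic.RingSolver.Core.AlmostCommutativeRing using (AlmostCommutativeRing; fromCommutativeRing)

open import Defs renaming (sym to adj-sym)

ℚ-ring : AlmostCommutativeRing _ _
ℚ-ring = fromCommutativeRing +-*-commutativeRing is-zero
  where
  is-zero : (x : ℚ) → Maybe (0ℚ ≡ x)
  is-zero x with 0ℚ ≟ℚ x
  ... | yes 0≡x = just 0≡x
  ... | no _    = nothing

module ℚ-Mult = SemiringMult (CommutativeRing.semiring +-*-commutativeRing)

𝟙 : Bool → ℚ
𝟙 true  = 1ℚ
𝟙 false = 0ℚ

𝟙-∧ : ∀ a b → 𝟙 (a ∧ b) ≡ 𝟙 a * 𝟙 b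
𝟙-∧ true  b = sym (*-identityˡ (𝟙 b))
𝟙-∧ false b = sym (*-zeroˡ (𝟙 b))

𝟙-not : ∀ a → 𝟙 (not a) ≡ 1ℚ - 𝟙 a
𝟙-not true  = refl
𝟙-not false = refl

fromℕ : ℕ → ℚ
fromℕ m = m ℚ-Mult.× 1ℚ

fromℕ-* : ∀ m n → fromℕ (m ℕ.* n) ≡ fromℕ m * fromℕ n
fromℕ-* = ℚ-Mult.×1-homo-*

fromℕ-nonNeg : ∀ m → 0ℚ ≤ fromℕ m
fromℕ-nonNeg zero    = ≤-refl
fromℕ-nonNeg (suc m) = +-mono-≤ (nonNegative⁻¹ 1ℚ) (fromℕ-nonNeg m)

fromℕ-mono : ∀ {m n} → m ℕ.≤ n → fromℕ m ≤ fromℕ n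
fromℕ-mono {zero}  {n}     _         = fromℕ-nonNeg n
fromℕ-mono {suc m} {suc n} (ℕ.s≤s p) = +-monoʳ-≤ 1ℚ (fromℕ-mono p)

fromℕ-pos : ∀ m .{{_ : NonZero m}} → Positive (fromℕ m)
fromℕ-pos (suc m) = pos+nonNeg⇒pos 1ℚ (fromℕ m) {{nonNegative (fromℕ-nonNeg m)}}

ℕ→ℚ-mkℚ : ∀ k → ℕ→ℚ k ≡ mkℚ (ℤ.+ k) 0 (Coprime.sym (1-coprimeTo k))
ℕ→ℚ-mkℚ k = normalize-coprime (Coprime.sym (1-coprimeTo k))

ℕ→ℚ-suc : ∀ k → ℕ→ℚ (suc k) ≡ 1ℚ + ℕ→ℚ k
ℕ→ℚ-suc k rewrite ℕ→ℚ-mkℚ k | ℕ→ℚ-mkℚ (suc k) =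
  toℚᵘ-injective (ℚᵘ.≃-trans (ℚᵘ.*≡* numerators) (ℚᵘ.≃-sym (toℚᵘ-homo-+ 1ℚ k/1)))
  where
  k/1 = mkℚ (ℤ.+ k) 0 (Coprime.sym (1-coprimeTo k))
  numerators : ℤ.+ suc k ℤ.* ℤ.+ 1 ≡ (ℤ.+ 1 ℤ.* ℤ.+ 1 ℤ.+ ℤ.+ k ℤ.* ℤ.+ 1) ℤ.* ℤ.+ 1
  numerators = ℤ-identity (ℤ.+ k)
    where ℤ-identity : ∀ z → (ℤ.+ 1 ℤ.+ z) ℤ.* ℤ.+ 1 ≡ (ℤ.+ 1 ℤ.* ℤ.+ 1 ℤ.+ z ℤ.* ℤ.+ 1) ℤ.* ℤ.+ 1
          ℤ-identity = ℤ-solve-∀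

fromℕ≡ℕ→ℚ : ∀ k → fromℕ k ≡ ℕ→ℚ k
fromℕ≡ℕ→ℚ zero    = refl
fromℕ≡ℕ→ℚ (suc k) = trans (cong (λ q → 1ℚ + q) (fromℕ≡ℕ→ℚ k)) (sym (ℕ→ℚ-suc k))

fromℕ*recip : ∀ m → fromℕ (suc m) * recip (suc m) ≡ 1ℚ
fromℕ*recip m
  rewrite fromℕ≡ℕ→ℚ (suc m) | ℕ→ℚ-mkℚ (suc m) | normalize-coprime {1} {m} (1-coprimeTo (suc m)) =
  *-inverseʳ (mkℚ (ℤ.+ suc m) 0 (Coprime.sym (1-coprimeTo (suc m))))

*-recip : ∀ m .{{_ : NonZero m}} {w c} → fromℕ m * w ≡ c → w ≡ c * recip m
*-recip (suc m) {w} {c} m*w≡c = begin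
  w                          ≡⟨ sym (*-identityˡ w) ⟩
  1ℚ * w                     ≡⟨ cong (_* w) (sym (trans (*-comm 1/m _) (fromℕ*recip m))) ⟩
  (1/m * fromℕ (suc m)) * w  ≡⟨ *-assoc 1/m _ w ⟩
  1/m * (fromℕ (suc m) * w)  ≡⟨ cong (1/m *_) m*w≡c ⟩
  1/m * c                    ≡⟨ *-comm 1/m c ⟩
  c * 1/m                    ∎
  where
  open ≡-Reasoning
  1/m = recip (suc m)

module _ {A : Set} where

  Σℚ-cong-∈ : ∀ (xs : List A) {f g : A → ℚ} → (∀ x → x ∈ xs → f x ≡ g x) → Σℚ xs f ≡ Σℚ xs g
  Σℚ-cong-∈ []       f≗g = refl
  Σℚ-cong-∈ (x ∷ xs) f≗g = cong₂ _+_ (f≗g x (here refl)) (Σℚ-cong-∈ xs (λ y → f≗g y ∘ there))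

  Σℚ-cong : ∀ (xs : List A) {f g : A → ℚ} → (∀ x → f x ≡ g x) → Σℚ xs f ≡ Σℚ xs g
  Σℚ-cong xs f≗g = Σℚ-cong-∈ xs (λ x _ → f≗g x)

  Σℚ-mono-∈ : ∀ (xs : List A) {f g : A → ℚ} → (∀ x → x ∈ xs → f x ≤ g x) → Σℚ xs f ≤ Σℚ xs g
  Σℚ-mono-∈ []       f≤g = ≤-refl
  Σℚ-mono-∈ (x ∷ xs) f≤g = +-mono-≤ (f≤g x (here refl)) (Σℚ-mono-∈ xs (λ y → f≤g y ∘ there))

  Σℚ-zero : ∀ (xs : List A) → Σℚ xs (λ _ → 0ℚ) ≡ 0ℚ
  Σℚ-zero []       = refl
  Σℚ-zero (x ∷ xs) = trans (+-identityˡ _) (Σℚ-zero xs)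

  Σℚ-++ : ∀ (xs ys : List A) (f : A → ℚ) → Σℚ (xs ++ ys) f ≡ Σℚ xs f + Σℚ ys f
  Σℚ-++ []       ys f = sym (+-identityˡ _)
  Σℚ-++ (x ∷ xs) ys f = trans (cong (f x +_) (Σℚ-++ xs ys f)) (sym (+-assoc (f x) _ _))

  Σℚ-+ : ∀ (xs : List A) (f g : A → ℚ) → Σℚ xs (λ x → f x + g x) ≡ Σℚ xs f + Σℚ xs g
  Σℚ-+ []       f g = refl
  Σℚ-+ (x ∷ xs) f g = trans (cong ((f x + g x) +_) (Σℚ-+ xs f g)) (interchange (f x) (g x) _ _)
    where interchange : ∀ a b c d → (a + b) + (c + d) ≡ (a + c) + (b + d)
          interchange = solve-∀ ℚ-ring

  Σℚ-*ˡ : ∀ (xs : List A) (c : ℚ) (f : A → ℚ) → Σℚ xs (λ x → c * f x) ≡ c * Σℚ xs f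
  Σℚ-*ˡ []       c f = sym (*-zeroʳ c)
  Σℚ-*ˡ (x ∷ xs) c f = trans (cong (c * f x +_) (Σℚ-*ˡ xs c f)) (sym (*-distribˡ-+ c (f x) _))

  Σℚ-neg : ∀ (xs : List A) (f : A → ℚ) → Σℚ xs (λ x → - f x) ≡ - Σℚ xs f
  Σℚ-neg []       f = refl
  Σℚ-neg (x ∷ xs) f = trans (cong (- f x +_) (Σℚ-neg xs f)) (sym (neg-distrib-+ (f x) _))

  Σℚ-const : ∀ (xs : List A) (c : ℚ) → Σℚ xs (λ _ → c) ≡ fromℕ (length xs) * c
  Σℚ-const []       c = sym (*-zeroˡ c)
  Σℚ-const (x ∷ xs) c = trans (cong (c +_) (Σℚ-const xs c)) (one-more c (fromℕ (length xs)))
    where one-more : ∀ c m → c + m * c ≡ (1ℚ + m) * c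
          one-more = solve-∀ ℚ-ring

  Σℚ-map : ∀ {B : Set} (h : A → B) (xs : List A) (f : B → ℚ) → Σℚ (map h xs) f ≡ Σℚ xs (λ x → f (h x))
  Σℚ-map h []       f = refl
  Σℚ-map h (x ∷ xs) f = cong (f (h x) +_) (Σℚ-map h xs f)

Σℚ-𝟙-not : ∀ {A : Set} (xs : List A) (b : A → Bool) →
            Σℚ xs (λ x → 𝟙 (not (b x))) ≡ fromℕ (length xs) - Σℚ xs (λ x → 𝟙 (b x))
Σℚ-𝟙-not xs b = begin
  Σℚ xs (λ x → 𝟙 (not (b x)))                 ≡⟨ Σℚ-cong xs (λ x → 𝟙-not (b x)) ⟩
  Σℚ xs (λ x → 1ℚ - 𝟙 (b x))                  ≡⟨ Σℚ-+ xs (λ _ → 1ℚ) (λ x → - 𝟙 (b x)) ⟩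
  Σℚ xs (λ _ → 1ℚ) + Σℚ xs (λ x → - 𝟙 (b x))
    ≡⟨ cong₂ _+_ (trans (Σℚ-const xs 1ℚ) (*-identityʳ (fromℕ (length xs)))) (Σℚ-neg xs (λ x → 𝟙 (b x))) ⟩
  fromℕ (length xs) - Σℚ xs (λ x → 𝟙 (b x))   ∎
  where open ≡-Reasoning

Σℚ-swap : ∀ {A B : Set} (xs : List A) (ys : List B) (f : A → B → ℚ) →
          Σℚ xs (λ x → Σℚ ys (f x)) ≡ Σℚ ys (λ y → Σℚ xs (λ x → f x y))
Σℚ-swap []       ys f = sym (Σℚ-zero ys)
Σℚ-swap (x ∷ xs) ys f =
  trans (cong (Σℚ ys (f x) +_) (Σℚ-swap xs ys f)) (sym (Σℚ-+ ys (f x) (λ y → Σℚ xs (λ x′ → f x′ y))))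

Σℚ-filter : ∀ {A : Set} {P : A → Set} (P? : Decidable P) xs (f : A → ℚ) →
            Σℚ (filter P? xs) f ≡ Σℚ xs (λ x → 𝟙 (does (P? x)) * f x)
Σℚ-filter P? []       f = refl
Σℚ-filter P? (x ∷ xs) f with does (P? x)
... | true  = cong₂ _+_ (sym (*-identityˡ (f x))) (Σℚ-filter P? xs f)
... | false = trans (Σℚ-filter P? xs f) (sym (trans (cong (_+ Σℚ-rest) (*-zeroˡ (f x))) (+-identityˡ Σℚ-rest)))
  where Σℚ-rest = Σℚ xs (λ x → 𝟙 (does (P? x)) * f x)

Σℚ-upTo-suc : ∀ M (F : ℕ → ℚ) → Σℚ (upTo (suc M)) F ≡ F 0 + Σℚ (upTo M) (λ i → F (suc i))
Σℚ-upTo-suc M F = cong (F 0 +_) (trans (cong (λ is → Σℚ is F) (sym (map-applyUpTo (λ i → i) suc M)))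
                                        (Σℚ-map suc (upTo M) F))

Σℚ-upTo-≡ᵇ : ∀ M j (g : ℕ → ℚ) → j ℕ.< M → Σℚ (upTo M) (λ i → 𝟙 (j ℕ.≡ᵇ i) * g i) ≡ g j
Σℚ-upTo-≡ᵇ (suc M) zero    g _ = begin
  Σℚ (upTo (suc M)) (λ i → 𝟙 (0 ℕ.≡ᵇ i) * g i)
    ≡⟨ Σℚ-upTo-suc M (λ i → 𝟙 (0 ℕ.≡ᵇ i) * g i) ⟩
  1ℚ * g 0 + Σℚ (upTo M) (λ i → 0ℚ * g (suc i))
    ≡⟨ cong₂ _+_ (*-identityˡ (g 0)) (Σℚ-cong (upTo M) (λ i → *-zeroˡ (g (suc i)))) ⟩
  g 0 + Σℚ (upTo M) (λ _ → 0ℚ)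
    ≡⟨ trans (cong (g 0 +_) (Σℚ-zero (upTo M))) (+-identityʳ (g 0)) ⟩
  g 0 ∎
  where open ≡-Reasoning
Σℚ-upTo-≡ᵇ (suc M) (suc j) g (ℕ.s≤s j<M) = begin
  Σℚ (upTo (suc M)) (λ i → 𝟙 (suc j ℕ.≡ᵇ i) * g i)
    ≡⟨ Σℚ-upTo-suc M (λ i → 𝟙 (suc j ℕ.≡ᵇ i) * g i) ⟩
  0ℚ * g 0 + Σ-rest
    ≡⟨ trans (cong (_+ Σ-rest) (*-zeroˡ (g 0))) (+-identityˡ Σ-rest) ⟩
  Σ-rest
    ≡⟨ Σℚ-upTo-≡ᵇ M j (λ i → g (suc i)) j<M ⟩
  g (suc j) ∎
  where
  open ≡-Reasoning
  Σ-rest = Σℚ (upTo M) (λ i → 𝟙 (j ℕ.≡ᵇ i) * g (suc i))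

Σℚ-sign-by-size : ∀ {A : Set} (size : A → ℕ) M (xs : List A) (f : A → ℚ) →
  (∀ x → x ∈ xs → size x ℕ.< M) →
  Σℚ (upTo M) (λ i → sign i * Σℚ (filter (λ x → size x ℕ.≟ i) xs) f) ≡ Σℚ xs (λ x → sign (size x) * f x)
Σℚ-sign-by-size size M xs f size<M = begin
  Σℚ (upTo M) (λ i → sign i * Σℚ (filter (λ x → size x ℕ.≟ i) xs) f)
    ≡⟨ Σℚ-cong (upTo M) (λ i → cong (sign i *_) (Σℚ-filter (λ x → size x ℕ.≟ i) xs f)) ⟩
  Σℚ (upTo M) (λ i → sign i * Σℚ xs (λ x → 𝟙 (size x ℕ.≡ᵇ i) * f x))
    ≡⟨ Σℚ-cong (upTo M) (λ i → sym (Σℚ-*ˡ xs (sign i) (λ x → 𝟙 (size x ℕ.≡ᵇ i) * f x))) ⟩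
  Σℚ (upTo M) (λ i → Σℚ xs (λ x → sign i * (𝟙 (size x ℕ.≡ᵇ i) * f x)))
    ≡⟨ Σℚ-swap (upTo M) xs (λ i x → sign i * (𝟙 (size x ℕ.≡ᵇ i) * f x)) ⟩
  Σℚ xs (λ x → Σℚ (upTo M) (λ i → sign i * (𝟙 (size x ℕ.≡ᵇ i) * f x)))
    ≡⟨ Σℚ-cong-∈ xs (λ x x∈xs →
         trans (Σℚ-cong (upTo M) (λ i → rearrange (sign i) (𝟙 (size x ℕ.≡ᵇ i)) (f x)))
               (Σℚ-upTo-≡ᵇ M (size x) (λ i → sign i * f x) (size<M x x∈xs))) ⟩
  Σℚ xs (λ x → sign (size x) * f x) ∎
  where
  open ≡-Reasoning
  rearrange : ∀ s δ a → s * (δ * a) ≡ δ * (s * a)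
  rearrange = solve-∀ ℚ-ring

module _ {A : Set} where

  selects : List A → List (A × List A)
  selects []       = []
  selects (x ∷ xs) = (x , xs) ∷ map (map₂ (x ∷_)) (selects xs)

  ∈-selects⁻ : ∀ {y ys x r} → (x , r) ∈ selects (y ∷ ys) →
               (x ≡ y × r ≡ ys) ⊎ ∃ λ r′ → (x , r′) ∈ selects ys × r ≡ y ∷ r′
  ∈-selects⁻ (here refl) = inj₁ (refl , refl)
  ∈-selects⁻ (there x,r∈) with ∈-map⁻ _ x,r∈
  ... | (_ , r′) , x,r′∈ , refl = inj₂ (r′ , x,r′∈ , refl)

  length-selects-∈ : ∀ L {x r} → (x , r) ∈ selects L → length L ≡ suc (length r)
  length-selects-∈ (y ∷ ys) x,r∈ with ∈-selects⁻ x,r∈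
  ... | inj₁ (refl , refl)       = refl
  ... | inj₂ (r′ , x,r′∈ , refl) = cong suc (length-selects-∈ ys x,r′∈)

  Σℚ-selects-∈ : ∀ L {x r} (f : A → ℚ) → (x , r) ∈ selects L → Σℚ L f ≡ f x + Σℚ r f
  Σℚ-selects-∈ (y ∷ ys) f x,r∈ with ∈-selects⁻ x,r∈
  ... | inj₁ (refl , refl)       = refl
  ... | inj₂ (r′ , x,r′∈ , refl) =
    trans (cong (f y +_) (Σℚ-selects-∈ ys f x,r′∈)) (swap-front (f y) (f _) (Σℚ r′ f))
    where swap-front : ∀ a b c → a + (b + c) ≡ b + (a + c)
          swap-front = solve-∀ ℚ-ring

  map-proj₁-selects : ∀ L → map proj₁ (selects L) ≡ L
  map-proj₁-selects []       = refl
  map-proj₁-selects (x ∷ xs) = cong (x ∷_) (trans (sym (map-∘ (selects xs))) (map-proj₁-selects xs))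

  length-selects : ∀ L → length (selects L) ≡ length L
  length-selects L = trans (sym (length-map proj₁ (selects L))) (cong length (map-proj₁-selects L))

  Σℚ-selects : ∀ L (f : A → ℚ) → Σℚ (selects L) (λ p → f (proj₁ p)) ≡ Σℚ L f
  Σℚ-selects L f = trans (sym (Σℚ-map proj₁ (selects L) f)) (cong (λ xs → Σℚ xs f) (map-proj₁-selects L))

  length-rest : ∀ {m} L {x r} → (x , r) ∈ selects L → length L ≡ suc m → length r ≡ m
  length-rest L x,r∈ |L|≡ = ℕ.suc-injective (trans (sym (length-selects-∈ L x,r∈)) |L|≡)

  data Ordering : List A → List A → Set where
    []  : Ordering [] []
    _∷_ : ∀ {L x r t} → (x , r) ∈ selects L → Ordering r t → Ordering L (x ∷ t)

  -- Σ-orderings (length L) L X sums X over all orderings of L (the first argument is fuel).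
  Σ-orderings : ℕ → List A → (List A → ℚ) → ℚ
  Σ-orderings zero    L X = X []
  Σ-orderings (suc m) L X = Σℚ (selects L) λ (x , r) → Σ-orderings m r (λ t → X (x ∷ t))

  Σ-orderings-zero : ∀ m L → Σ-orderings m L (λ _ → 0ℚ) ≡ 0ℚ
  Σ-orderings-zero zero    L = refl
  Σ-orderings-zero (suc m) L =
    trans (Σℚ-cong (selects L) (λ (_ , r) → Σ-orderings-zero m r)) (Σℚ-zero (selects L))

  Σ-orderings-+ : ∀ m L (X Y : List A → ℚ) →
                  Σ-orderings m L (λ t → X t + Y t) ≡ Σ-orderings m L X + Σ-orderings m L Y
  Σ-orderings-+ zero    L X Y = refl
  Σ-orderings-+ (suc m) L X Y =
    trans (Σℚ-cong (selects L) (λ (x , r) → Σ-orderings-+ m r (λ t → X (x ∷ t)) (λ t → Y (x ∷ t))))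
          (Σℚ-+ (selects L) (λ (x , r) → Σ-orderings m r (λ t → X (x ∷ t)))
                              (λ (x , r) → Σ-orderings m r (λ t → Y (x ∷ t))))

  Σ-orderings-*ˡ : ∀ m L c (X : List A → ℚ) → Σ-orderings m L (λ t → c * X t) ≡ c * Σ-orderings m L X
  Σ-orderings-*ˡ zero    L c X = refl
  Σ-orderings-*ˡ (suc m) L c X =
    trans (Σℚ-cong (selects L) (λ (x , r) → Σ-orderings-*ˡ m r c (λ t → X (x ∷ t))))
          (Σℚ-*ˡ (selects L) c (λ (x , r) → Σ-orderings m r (λ t → X (x ∷ t))))

  Σ-orderings-Σℚ : ∀ {B : Set} m L (ys : List B) (f : B → List A → ℚ) →
                   Σ-orderings m L (λ t → Σℚ ys (λ y → f y t)) ≡ Σℚ ys (λ y → Σ-orderings m L (f y))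
  Σ-orderings-Σℚ m L []       f = Σ-orderings-zero m L
  Σ-orderings-Σℚ m L (y ∷ ys) f =
    trans (Σ-orderings-+ m L (f y) _) (cong (Σ-orderings m L (f y) +_) (Σ-orderings-Σℚ m L ys f))

  Σ-orderings-const : ∀ m L c → length L ≡ m → Σ-orderings m L (λ _ → c) ≡ fromℕ (m !) * c
  Σ-orderings-const zero    [] c refl = sym (*-identityˡ c)
  Σ-orderings-const (suc m) L  c |L|≡ = begin
    Σℚ (selects L) (λ (x , r) → Σ-orderings m r (λ _ → c))
      ≡⟨ Σℚ-cong-∈ (selects L) (λ (x , r) x,r∈ → Σ-orderings-const m r c (length-rest L x,r∈ |L|≡)) ⟩
    Σℚ (selects L) (λ _ → fromℕ (m !) * c)
      ≡⟨ Σℚ-const (selects L) _ ⟩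
    fromℕ (length (selects L)) * (fromℕ (m !) * c)
      ≡⟨ cong (λ k → fromℕ k * (fromℕ (m !) * c)) (trans (length-selects L) |L|≡) ⟩
    fromℕ (suc m) * (fromℕ (m !) * c)
      ≡⟨ sym (trans (cong (_* c) (fromℕ-* (suc m) (m !))) (*-assoc (fromℕ (suc m)) (fromℕ (m !)) c)) ⟩
    fromℕ (suc m !) * c ∎
    where open ≡-Reasoning

  Σ-orderings-mono : ∀ m L {X Y : List A → ℚ} → length L ≡ m →
                     (∀ t → Ordering L t → X t ≤ Y t) → Σ-orderings m L X ≤ Σ-orderings m L Y
  Σ-orderings-mono zero    [] refl X≤Y = X≤Y [] []
  Σ-orderings-mono (suc m) L  |L|≡ X≤Y = Σℚ-mono-∈ (selects L) λ (x , r) x,r∈ →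
    Σ-orderings-mono m r (length-rest L x,r∈ |L|≡) (λ t ord → X≤Y (x ∷ t) (x,r∈ ∷ ord))

  Σ-orderings-lower : ∀ m L c (X : List A → ℚ) → length L ≡ m →
                      (∀ t → Ordering L t → c ≤ X t) → fromℕ (m !) * c ≤ Σ-orderings m L X
  Σ-orderings-lower m L c X |L|≡ c≤X = begin
    fromℕ (m !) * c              ≡⟨ sym (Σ-orderings-const m L c |L|≡) ⟩
    Σ-orderings m L (λ _ → c)    ≤⟨ Σ-orderings-mono m L |L|≡ c≤X ⟩
    Σ-orderings m L X            ∎
    where open ≤-Reasoning

  firstHit : (A → Bool) → (A → Bool) → List A → Bool
  firstHit e s []      = false
  firstHit e s (x ∷ t) = if e x then true else if s x then false else firstHit e s t

  -- With E, S the elements where e, s hold: a proportion |E|/|E ∪ S| of the orderings of L meets E ∪ S first in E.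
  Σ-orderings-firstHit : ∀ m L (e s : A → Bool) → length L ≡ m →
    Σℚ L (λ x → 𝟙 (e x ∨ s x)) * Σ-orderings m L (λ t → 𝟙 (firstHit e s t))
      ≡ Σℚ L (λ x → 𝟙 (e x)) * fromℕ (m !)
  Σ-orderings-firstHit zero    [] e s refl = trans (*-zeroˡ 0ℚ) (sym (*-zeroˡ 1ℚ))
  Σ-orderings-firstHit (suc m) L  e s |L|≡ = begin
    #ES * Σℚ (selects L) (λ (x , r) → Σ-orderings m r (λ t → hit (x ∷ t)))
      ≡⟨ sym (Σℚ-*ˡ (selects L) #ES (λ (x , r) → Σ-orderings m r (λ t → hit (x ∷ t)))) ⟩
    Σℚ (selects L) (λ (x , r) → #ES * Σ-orderings m r (λ t → hit (x ∷ t)))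
      ≡⟨ Σℚ-cong-∈ (selects L) (λ (x , r) x,r∈ → term x r x,r∈ (length-rest L x,r∈ |L|≡)) ⟩
    Σℚ (selects L) (λ (x , r) → h x)
      ≡⟨ Σℚ-selects L h ⟩
    Σℚ L h
      ≡⟨ Σℚ-+ L (λ x → (#ES * m!) * 𝟙 (e x)) (λ x → (#E * m!) * 𝟙 (not (e x ∨ s x))) ⟩
    Σℚ L (λ x → (#ES * m!) * 𝟙 (e x)) + Σℚ L (λ x → (#E * m!) * 𝟙 (not (e x ∨ s x)))
      ≡⟨ cong₂ _+_ (Σℚ-*ˡ L (#ES * m!) (λ x → 𝟙 (e x)))
                   (trans (Σℚ-*ˡ L (#E * m!) (λ x → 𝟙 (not (e x ∨ s x)))) (cong (#E * m! *_) #neither)) ⟩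
    (#ES * m!) * #E + (#E * m!) * (fromℕ (suc m) - #ES)
      ≡⟨ collect #ES #E (fromℕ (suc m)) m! ⟩
    #E * (fromℕ (suc m) * m!)
      ≡⟨ cong (#E *_) (sym (fromℕ-* (suc m) (m !))) ⟩
    #E * fromℕ (suc m !) ∎
    where
    open ≡-Reasoning
    hit = λ t → 𝟙 (firstHit e s t)
    m! = fromℕ (m !)
    #ES = Σℚ L (λ x → 𝟙 (e x ∨ s x))
    #E  = Σℚ L (λ x → 𝟙 (e x))
    h : A → ℚ
    h x = (#ES * m!) * 𝟙 (e x) + (#E * m!) * 𝟙 (not (e x ∨ s x))

    collect : ∀ es e n f → (es * f) * e + (e * f) * (n - es) ≡ e * (n * f)
    collect = solve-∀ ℚ-ring

    #neither : Σℚ L (λ x → 𝟙 (not (e x ∨ s x))) ≡ fromℕ (suc m) - #ES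
    #neither = trans (Σℚ-𝟙-not L (λ x → e x ∨ s x)) (cong (λ k → fromℕ k - #ES) |L|≡)

    term : ∀ x r → (x , r) ∈ selects L → length r ≡ m → #ES * Σ-orderings m r (λ t → hit (x ∷ t)) ≡ h x
    term x r x,r∈ |r|≡ with e x in ex | s x in sx
    ... | true  | _     = trans (cong (#ES *_) (Σ-orderings-const m r 1ℚ |r|≡)) (ring₁ #ES m! (#E * m!))
      where ring₁ : ∀ a b c → a * (b * 1ℚ) ≡ (a * b) * 1ℚ + c * 0ℚ
            ring₁ = solve-∀ ℚ-ring
    ... | false | true  = trans (cong (#ES *_) (Σ-orderings-const m r 0ℚ |r|≡)) (ring₀ #ES m! (#E * m!))
      where ring₀ : ∀ a b c → a * (b * 0ℚ) ≡ (a * b) * 0ℚ + c * 0ℚ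
            ring₀ = solve-∀ ℚ-ring
    ... | false | false = begin
      #ES * Σ-orderings m r hit
        ≡⟨ cong (_* Σ-orderings m r hit)
                (Σℚ-selects-∈-0 (λ y → 𝟙 (e y ∨ s y)) (cong₂ (λ a b → 𝟙 (a ∨ b)) ex sx)) ⟩
      Σℚ r (λ y → 𝟙 (e y ∨ s y)) * Σ-orderings m r hit
        ≡⟨ Σ-orderings-firstHit m r e s |r|≡ ⟩
      Σℚ r (λ y → 𝟙 (e y)) * m!
        ≡⟨ cong (_* m!) (sym (Σℚ-selects-∈-0 (λ y → 𝟙 (e y)) (cong 𝟙 ex))) ⟩
      #E * m!
        ≡⟨ ring₁ (#E * m!) (#ES * m!) ⟩
      (#ES * m!) * 0ℚ + (#E * m!) * 1ℚ ∎
      where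
      ring₁ : ∀ a b → a ≡ b * 0ℚ + a * 1ℚ
      ring₁ = solve-∀ ℚ-ring
      Σℚ-selects-∈-0 : (f : A → ℚ) → f x ≡ 0ℚ → Σℚ L f ≡ Σℚ r f
      Σℚ-selects-∈-0 f fx≡0 = trans (Σℚ-selects-∈ L f x,r∈) (trans (cong (_+ Σℚ r f) fx≡0) (+-identityˡ _))

module _ {A : Set} where

  selects-↭ : ∀ (L : List A) {x r} → (x , r) ∈ selects L → L ↭ x ∷ r
  selects-↭ (y ∷ ys) {x} x,r∈ with ∈-selects⁻ x,r∈
  ... | inj₁ (refl , refl)       = ↭-refl
  ... | inj₂ (r′ , x,r′∈ , refl) = ↭-trans (↭-prep y (selects-↭ ys x,r′∈)) (↭-swap y x ↭-refl)

  Ordering⇒↭ : ∀ {L t : List A} → Ordering L t → L ↭ t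
  Ordering⇒↭             []           = ↭-refl
  Ordering⇒↭ {L} {x ∷ t} (x,r∈ ∷ ord) = ↭-trans (selects-↭ L x,r∈) (↭-prep x (Ordering⇒↭ ord))

module _ {A : Set} (e : A → Bool) where

  firstHit-cong : ∀ {s s′ : A → Bool} → (∀ x → s x ≡ s′ x) → ∀ t → firstHit e s t ≡ firstHit e s′ t
  firstHit-cong s≗s′ []      = refl
  firstHit-cong s≗s′ (x ∷ t) rewrite s≗s′ x | firstHit-cong s≗s′ t = refl

  firstHit-absorb : ∀ s t → firstHit e (λ x → e x ∨ s x) t ≡ firstHit e s t
  firstHit-absorb s []      = refl
  firstHit-absorb s (x ∷ t) with e x
  ... | true  = refl
  ... | false = cong (if s x then false else_) (firstHit-absorb s t)

  firstHit-∨ : ∀ s₁ s₂ t → firstHit e (λ x → s₁ x ∨ s₂ x) t ≡ firstHit e s₁ t ∧ firstHit e s₂ t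
  firstHit-∨ s₁ s₂ []      = refl
  firstHit-∨ s₁ s₂ (x ∷ t) with e x | s₁ x | s₂ x
  ... | true  | _     | _     = refl
  ... | false | true  | _     = refl
  ... | false | false | true  = sym (Bool.∧-zeroʳ _)
  ... | false | false | false = firstHit-∨ s₁ s₂ t

T-ext : ∀ {a b} → (T a → T b) → (T b → T a) → a ≡ b
T-ext {true}  {true}  _ _ = refl
T-ext {true}  {false} f _ = ⊥-elim (f _)
T-ext {false} {true}  _ g = ⊥-elim (g _)
T-ext {false} {false} _ _ = refl

lookup-ext : ∀ {n} {p q : Subset n} → (∀ x → lookup p x ≡ lookup q x) → p ≡ q
lookup-ext {p = p} {q} p≗q = trans (sym (tabulate∘lookup p)) (trans (tabulate-cong p≗q) (tabulate∘lookup q))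

lookup-∪ : ∀ {n} (p q : Subset n) x → lookup (p ∪ q) x ≡ lookup p x ∨ lookup q x
lookup-∪ p q x = lookup-zipWith _∨_ x p q

lookup-─ : ∀ {n} (p q : Subset n) x → lookup (p ─ q) x ≡ lookup p x ∧ not (lookup q x)
lookup-─ (b ∷ p) (true  ∷ q) fzero    = sym (Bool.∧-zeroʳ b)
lookup-─ (b ∷ p) (false ∷ q) fzero    = sym (Bool.∧-identityʳ b)
lookup-─ (b ∷ p) (_     ∷ q) (fsuc x) = lookup-─ p q x

lookup-⁅⁆ : ∀ {n} (y x : Fin n) → lookup ⁅ y ⁆ x ≡ does (x ≟ y)
lookup-⁅⁆ fzero    fzero    = refl
lookup-⁅⁆ fzero    (fsuc x) = lookup-replicate x outside
lookup-⁅⁆ (fsuc y) fzero    = refl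
lookup-⁅⁆ (fsuc y) (fsuc x) = lookup-⁅⁆ y x

0<∣∣ : ∀ {n} (S : Subset n) u → lookup S u ≡ true → 0 ℕ.< ∣ S ∣
0<∣∣ (true  ∷ S) fzero    _    = ℕ.s≤s ℕ.z≤n
0<∣∣ (true  ∷ S) (fsuc u) _    = ℕ.s≤s ℕ.z≤n
0<∣∣ (false ∷ S) (fsuc u) S[u] = 0<∣∣ S u S[u]

Σℚ-𝟙-lookup : ∀ {m} (S : Subset m) → Σℚ (allFin m) (λ x → 𝟙 (lookup S x)) ≡ fromℕ ∣ S ∣
Σℚ-𝟙-lookup []      = refl
Σℚ-𝟙-lookup {suc m} (b ∷ S) = begin
  𝟙 b + Σℚ (Data.List.tabulate fsuc) (λ x → 𝟙 (lookup (b ∷ S) x))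
    ≡⟨ cong (λ xs → 𝟙 b + Σℚ xs (λ x → 𝟙 (lookup (b ∷ S) x))) (sym (map-tabulate (λ x → x) fsuc)) ⟩
  𝟙 b + Σℚ (map fsuc (allFin m)) (λ x → 𝟙 (lookup (b ∷ S) x))
    ≡⟨ cong (𝟙 b +_) (trans (Σℚ-map fsuc (allFin m) (λ x → 𝟙 (lookup (b ∷ S) x))) (Σℚ-𝟙-lookup S)) ⟩
  𝟙 b + fromℕ ∣ S ∣
    ≡⟨ count-head b ⟩
  fromℕ ∣ b ∷ S ∣ ∎
  where
  open ≡-Reasoning
  count-head : ∀ b → 𝟙 b + fromℕ ∣ S ∣ ≡ fromℕ ∣ b ∷ S ∣
  count-head true  = refl
  count-head false = +-identityˡ (fromℕ ∣ S ∣)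

anyIn : ∀ {m} → Subset m → (Fin m → Bool) → Bool
anyIn []      e = false
anyIn (b ∷ p) e = (b ∧ e fzero) ∨ anyIn p (λ i → e (fsuc i))

allIn : ∀ {m} → Subset m → (Fin m → Bool) → Bool
allIn []      e = true
allIn (b ∷ p) e = (not b ∨ e fzero) ∧ allIn p (λ i → e (fsuc i))

Σℚ-subsetsOf-∷ : ∀ {m} b (p : Subset m) (f : Subset (suc m) → ℚ) →
  Σℚ (subsetsOf (b ∷ p)) f
    ≡ Σℚ (subsetsOf p) (λ I → f (outside ∷ I)) + 𝟙 b * Σℚ (subsetsOf p) (λ I → f (inside ∷ I))
Σℚ-subsetsOf-∷ false p f = begin
  Σℚ (map (outside ∷_) (subsetsOf p)) f   ≡⟨ Σℚ-map (outside ∷_) (subsetsOf p) f ⟩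
  Σ-out                                    ≡⟨ sym (+-identityʳ Σ-out) ⟩
  Σ-out + 0ℚ                               ≡⟨ cong (Σ-out +_) (sym (*-zeroˡ Σ-in)) ⟩
  Σ-out + 0ℚ * Σ-in                        ∎
  where
  open ≡-Reasoning
  Σ-out = Σℚ (subsetsOf p) (λ I → f (outside ∷ I))
  Σ-in  = Σℚ (subsetsOf p) (λ I → f (inside ∷ I))
Σℚ-subsetsOf-∷ true p f = begin
  Σℚ (map (outside ∷_) (subsetsOf p) ++ map (inside ∷_) (subsetsOf p)) f
    ≡⟨ Σℚ-++ (map (outside ∷_) (subsetsOf p)) _ f ⟩
  Σℚ (map (outside ∷_) (subsetsOf p)) f + Σℚ (map (inside ∷_) (subsetsOf p)) f
    ≡⟨ cong₂ _+_ (Σℚ-map (outside ∷_) (subsetsOf p) f)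
                 (trans (Σℚ-map (inside ∷_) (subsetsOf p) f) (sym (*-identityˡ Σ-in))) ⟩
  Σ-out + 1ℚ * Σ-in ∎
  where
  open ≡-Reasoning
  Σ-out = Σℚ (subsetsOf p) (λ I → f (outside ∷ I))
  Σ-in  = Σℚ (subsetsOf p) (λ I → f (inside ∷ I))

inclusion-exclusion : ∀ {m} (p : Subset m) (e : Fin m → Bool) →
  Σℚ (subsetsOf p) (λ I → sign ∣ I ∣ * 𝟙 (allIn I e)) ≡ 𝟙 (not (anyIn p e))
inclusion-exclusion []      e = refl
inclusion-exclusion (b ∷ p) e = begin
  Σℚ (subsetsOf (b ∷ p)) (λ I → sign ∣ I ∣ * 𝟙 (allIn I e))
    ≡⟨ Σℚ-subsetsOf-∷ b p (λ I → sign ∣ I ∣ * 𝟙 (allIn I e)) ⟩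
  Σℚ (subsetsOf p) F + 𝟙 b * Σℚ (subsetsOf p) (λ I → - sign ∣ I ∣ * 𝟙 (e fzero ∧ allIn I e′))
    ≡⟨ cong₂ (λ x y → x + 𝟙 b * y) (inclusion-exclusion p e′) head-in-I ⟩
  𝟙 (not (anyIn p e′)) + 𝟙 b * - (𝟙 (e fzero) * 𝟙 (not (anyIn p e′)))
    ≡⟨ combine b (e fzero) (anyIn p e′) ⟩
  𝟙 (not (anyIn (b ∷ p) e)) ∎
  where
  open ≡-Reasoning
  e₀ = e fzero
  e′ = λ i → e (fsuc i)
  F = λ I → sign ∣ I ∣ * 𝟙 (allIn I e′)

  head-in-I : Σℚ (subsetsOf p) (λ I → - sign ∣ I ∣ * 𝟙 (e₀ ∧ allIn I e′)) ≡ - (𝟙 e₀ * 𝟙 (not (anyIn p e′)))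
  head-in-I = begin
    Σℚ (subsetsOf p) (λ I → - sign ∣ I ∣ * 𝟙 (e₀ ∧ allIn I e′))
      ≡⟨ Σℚ-cong (subsetsOf p) (λ I → trans (cong (- sign ∣ I ∣ *_) (𝟙-∧ e₀ (allIn I e′)))
                                            (rearrange (sign ∣ I ∣) (𝟙 e₀) (𝟙 (allIn I e′)))) ⟩
    Σℚ (subsetsOf p) (λ I → - (𝟙 e₀ * F I))
      ≡⟨ Σℚ-neg (subsetsOf p) (λ I → 𝟙 e₀ * F I) ⟩
    - Σℚ (subsetsOf p) (λ I → 𝟙 e₀ * F I)
      ≡⟨ cong -_ (trans (Σℚ-*ˡ (subsetsOf p) (𝟙 e₀) F) (cong (𝟙 e₀ *_) (inclusion-exclusion p e′))) ⟩
    - (𝟙 e₀ * 𝟙 (not (anyIn p e′))) ∎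
    where rearrange : ∀ s a x → - s * (a * x) ≡ - (a * (s * x))
          rearrange = solve-∀ ℚ-ring

  combine : ∀ b a x → 𝟙 (not x) + 𝟙 b * - (𝟙 a * 𝟙 (not x)) ≡ 𝟙 (not ((b ∧ a) ∨ x))
  combine true  true  false = refl
  combine true  true  true  = refl
  combine true  false x     = trans (cong (𝟙 (not x) +_) (trans (*-identityˡ _) (cong -_ (*-zeroˡ (𝟙 (not x))))))
                                    (+-identityʳ (𝟙 (not x)))
  combine false a     x     = trans (cong (𝟙 (not x) +_) (*-zeroˡ (- (𝟙 a * 𝟙 (not x)))))
                                    (+-identityʳ (𝟙 (not x)))

anyIn⇒∃ : ∀ {m} (p : Subset m) e → anyIn p e ≡ true → ∃ λ v → lookup p v ≡ true × e v ≡ true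
anyIn⇒∃ (false ∷ p) e any with anyIn⇒∃ p (λ i → e (fsuc i)) any
... | v , p[v] , e[v] = fsuc v , p[v] , e[v]
anyIn⇒∃ (true ∷ p) e any with e fzero in e[0]
... | true  = fzero , refl , e[0]
... | false with anyIn⇒∃ p (λ i → e (fsuc i)) any
...   | v , p[v] , e[v] = fsuc v , p[v] , e[v]

T-allIn⁻ : ∀ {m} (I : Subset m) e → T (allIn I e) → ∀ v → lookup I v ≡ true → T (e v)
T-allIn⁻ (true  ∷ I) e every fzero    _    = proj₁ (Equivalence.to (T-∧ {e fzero}) every)
T-allIn⁻ (true  ∷ I) e every (fsuc v) I[v] = T-allIn⁻ I _ (proj₂ (Equivalence.to (T-∧ {e fzero}) every)) v I[v]
T-allIn⁻ (false ∷ I) e every (fsuc v) I[v] = T-allIn⁻ I _ every v I[v]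

T-allIn⁺ : ∀ {m} (I : Subset m) e → (∀ v → lookup I v ≡ true → T (e v)) → T (allIn I e)
T-allIn⁺ []          e _   = _
T-allIn⁺ (true  ∷ I) e every = Equivalence.from T-∧ (every fzero refl , T-allIn⁺ I _ (λ v → every (fsuc v)))
T-allIn⁺ (false ∷ I) e every = T-allIn⁺ I _ (λ v → every (fsuc v))

all-elements : ∀ {m} (I : Subset m) e → all e (elements I) ≡ allIn I e
all-elements {m} I e = T-ext
  (λ all-e → T-allIn⁺ I e (λ v I[v] → All.lookup (all⁺ e _ all-e) (∈-filter⁺ in-I? (∈-allFin v) I[v])))
  (λ all-e → all⁻ e (All.tabulate λ {v} v∈ → T-allIn⁻ I e all-e v (proj₂ (∈-filter⁻ in-I? {xs = allFin m} v∈))))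
  where in-I? = λ v → lookup I v Bool.≟ true

subsetsOf-∣∣≤ : ∀ {m} (p : Subset m) I → I ∈ subsetsOf p → ∣ I ∣ ℕ.≤ ∣ p ∣
subsetsOf-∣∣≤ []          .[] (here refl) = ℕ.z≤n
subsetsOf-∣∣≤ (false ∷ p) I   I∈ with ∈-map⁻ (outside ∷_) I∈
... | I′ , I′∈ , refl = subsetsOf-∣∣≤ p I′ I′∈
subsetsOf-∣∣≤ (true ∷ p)  I   I∈ with ∈-++⁻ (map (outside ∷_) (subsetsOf p)) I∈
... | inj₁ I∈out with ∈-map⁻ (outside ∷_) I∈out
...   | I′ , I′∈ , refl = ℕ.m≤n⇒m≤1+n (subsetsOf-∣∣≤ p I′ I′∈)
subsetsOf-∣∣≤ (true ∷ p)  I   I∈ | inj₂ I∈in with ∈-map⁻ (inside ∷_) I∈in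
...   | I′ , I′∈ , refl = ℕ.s≤s (subsetsOf-∣∣≤ p I′ I′∈)

Σℚ-binom : ∀ {m} (p : Subset m) (f : Subset m → ℚ) →
  Σℚ (upTo (suc ∣ p ∣)) (λ i → sign i * Σℚ (binom p i) f) ≡ Σℚ (subsetsOf p) (λ I → sign ∣ I ∣ * f I)
Σℚ-binom p f = Σℚ-sign-by-size ∣_∣ (suc ∣ p ∣) (subsetsOf p) f (λ I I∈ → ℕ.s≤s (subsetsOf-∣∣≤ p I I∈))

module _ {n : ℕ} where
  open import Data.List.Membership.DecPropositional (_≟_ {n}) using (_∈?_)

  firstIn : List (Fin n) → Fin n → Subset n → Bool
  firstIn π u A = firstHit (λ x → does (x ≟ u)) (lookup A) π

  firstIn-∪ : ∀ π u (X Y : Subset n) → firstIn π u (X ∪ Y) ≡ firstIn π u X ∧ firstIn π u Y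
  firstIn-∪ π u X Y = trans (firstHit-cong _ (lookup-∪ X Y) π) (firstHit-∨ _ (lookup X) (lookup Y) π)

  firstIn-⁅⁆-∪ : ∀ π u (X : Subset n) → firstIn π u (⁅ u ⁆ ∪ X) ≡ firstIn π u X
  firstIn-⁅⁆-∪ π u X =
    trans (firstHit-cong _ (λ x → trans (lookup-∪ ⁅ u ⁆ X x) (cong (_∨ lookup X x) (lookup-⁅⁆ u x))) π)
          (firstHit-absorb _ (lookup X) π)

  firstIn-⋃ : ∀ π u (f : Fin n → Subset n) vs →
              firstIn π u (⋃ (map f vs)) ≡ all (λ v → firstIn π u (f v)) vs ∧ firstIn π u ∅
  firstIn-⋃ π u f []       = refl
  firstIn-⋃ π u f (v ∷ vs) = begin
    firstIn π u (f v ∪ ⋃ (map f vs))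
      ≡⟨ firstIn-∪ π u (f v) (⋃ (map f vs)) ⟩
    firstIn π u (f v) ∧ firstIn π u (⋃ (map f vs))
      ≡⟨ cong (firstIn π u (f v) ∧_) (firstIn-⋃ π u f vs) ⟩
    firstIn π u (f v) ∧ (all (λ v → firstIn π u (f v)) vs ∧ firstIn π u ∅)
      ≡⟨ sym (Bool.∧-assoc (firstIn π u (f v)) _ _) ⟩
    (firstIn π u (f v) ∧ all (λ v → firstIn π u (f v)) vs) ∧ firstIn π u ∅ ∎
    where open ≡-Reasoning

  firstIn-∅ : ∀ {u π} → u ∈ π → firstIn π u ∅ ≡ true
  firstIn-∅ {u} (here refl) rewrite dec-true (u ≟ u) refl = refl
  firstIn-∅ {u} {x ∷ π} (there u∈π) with does (x ≟ u)
  ... | true  = refl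
  ... | false rewrite lookup-replicate x outside = firstIn-∅ u∈π

  firstIn-∷ : ∀ {w y} rest (A : Subset n) → w ≢ y → firstIn (w ∷ rest) y A ≡ true →
              lookup A w ≡ false × firstIn rest y A ≡ true
  firstIn-∷ {w} {y} rest A w≢y first with w ≟ y
  ... | yes w≡y = ⊥-elim (w≢y w≡y)
  ... | no  _   with lookup A w
  ...   | false = refl , first

  covered : Graph n → Fin n → Subset n → Subset n
  covered G u I = ⁅ u ⁆ ∪ ⋃ (map (N[_] G) (elements I))

  firstIn-covered : ∀ G {π u} (I : Subset n) → u ∈ π →
                    firstIn π u (covered G u I) ≡ allIn I (λ v → firstIn π u (N[_] G v))
  firstIn-covered G {π} {u} I u∈π = begin
    firstIn π u (covered G u I)
      ≡⟨ firstIn-⁅⁆-∪ π u _ ⟩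
    firstIn π u (⋃ (map (N[_] G) (elements I)))
      ≡⟨ firstIn-⋃ π u (N[_] G) (elements I) ⟩
    all (λ v → firstIn π u (N[_] G v)) (elements I) ∧ firstIn π u ∅
      ≡⟨ cong₂ _∧_ (all-elements I _) (firstIn-∅ u∈π) ⟩
    allIn I (λ v → firstIn π u (N[_] G v)) ∧ true
      ≡⟨ Bool.∧-identityʳ _ ⟩
    allIn I (λ v → firstIn π u (N[_] G v)) ∎
    where open ≡-Reasoning

  u∈covered : ∀ G u I → lookup (covered G u I) u ≡ true
  u∈covered G u I =
    trans (lookup-∪ ⁅ u ⁆ ⋃N u) (cong (_∨ lookup ⋃N u) (trans (lookup-⁅⁆ u u) (dec-true (u ≟ u) refl)))
    where ⋃N = ⋃ (map (N[_] G) (elements I))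

  forcingSet : Graph n → List (Fin n) → Subset n
  forcingSet G π = tabulate λ u → not (anyIn (N G u) (λ v → firstIn π u (N[_] G v)))

  expansion : Graph n → List (Fin n) → Fin n → ℚ
  expansion G π u =
    Σℚ (upTo (suc (deg G u))) λ i → sign i * Σℚ (binom (N G u) i) λ I → 𝟙 (firstIn π u (covered G u I))

  𝟙-forcingSet : ∀ G {π} u → u ∈ π → 𝟙 (lookup (forcingSet G π) u) ≡ expansion G π u
  𝟙-forcingSet G {π} u u∈π = sym (begin
    expansion G π u
      ≡⟨ Σℚ-binom (N G u) (λ I → 𝟙 (firstIn π u (covered G u I))) ⟩
    Σℚ (subsetsOf (N G u)) (λ I → sign ∣ I ∣ * 𝟙 (firstIn π u (covered G u I)))
      ≡⟨ Σℚ-cong (subsetsOf (N G u)) (λ I → cong (λ b → sign ∣ I ∣ * 𝟙 b) (firstIn-covered G I u∈π)) ⟩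
    Σℚ (subsetsOf (N G u)) (λ I → sign ∣ I ∣ * 𝟙 (allIn I (λ v → firstIn π u (N[_] G v))))
      ≡⟨ inclusion-exclusion (N G u) (λ v → firstIn π u (N[_] G v)) ⟩
    𝟙 (not (anyIn (N G u) (λ v → firstIn π u (N[_] G v))))
      ≡⟨ cong 𝟙 (sym (lookup∘tabulate _ u)) ⟩
    𝟙 (lookup (forcingSet G π) u) ∎)
    where open ≡-Reasoning

  listSet : List (Fin n) → Subset n
  listSet t = tabulate λ x → does (x ∈? t)

  lookup-∪-listSet : ∀ (Z : Subset n) t x → lookup (Z ∪ listSet t) x ≡ lookup Z x ∨ does (x ∈? t)
  lookup-∪-listSet Z t x = trans (lookup-∪ Z (listSet t) x) (cong (lookup Z x ∨_) (lookup∘tabulate _ x))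

  ∪-listSet-∷ : ∀ (Z : Subset n) w rest → (Z ∪ listSet rest) ∪ ⁅ w ⁆ ≡ Z ∪ listSet (w ∷ rest)
  ∪-listSet-∷ Z w rest = lookup-ext λ x → begin
    lookup ((Z ∪ listSet rest) ∪ ⁅ w ⁆) x
      ≡⟨ trans (lookup-∪ (Z ∪ listSet rest) ⁅ w ⁆ x) (cong₂ _∨_ (lookup-∪-listSet Z rest x) (lookup-⁅⁆ w x)) ⟩
    (lookup Z x ∨ does (x ∈? rest)) ∨ does (x ≟ w)
      ≡⟨ trans (Bool.∨-assoc (lookup Z x) _ _) (cong (lookup Z x ∨_) (Bool.∨-comm (does (x ∈? rest)) _)) ⟩
    lookup Z x ∨ does (x ∈? (w ∷ rest))
      ≡⟨ sym (lookup-∪-listSet Z (w ∷ rest) x) ⟩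
    lookup (Z ∪ listSet (w ∷ rest)) x ∎
    where open ≡-Reasoning

  ∪-listSet-∷-∈ : ∀ (Z : Subset n) {w} rest → lookup Z w ≡ true →
                  Z ∪ listSet rest ≡ Z ∪ listSet (w ∷ rest)
  ∪-listSet-∷-∈ Z {w} rest Z[w] = lookup-ext λ x →
    trans (lookup-∪-listSet Z rest x) (sym (trans (lookup-∪-listSet Z (w ∷ rest) x) (absorb x)))
    where
    absorb : ∀ x → lookup Z x ∨ does (x ∈? (w ∷ rest)) ≡ lookup Z x ∨ does (x ∈? rest)
    absorb x with x ≟ w
    ... | yes refl rewrite Z[w] = refl
    ... | no  _    = refl

  module _ (G : Graph n) (π : List (Fin n)) (π-complete : ∀ u → u ∈ π) where

    private
      Z = forcingSet G π

    -- Every suffix of π is a tail.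
    IsTail : List (Fin n) → Set
    IsTail t = ∀ A y → firstIn π y A ≡ true → y ∈ t →
               (∀ x → lookup A x ≡ true → x ∈ t) × firstIn t y A ≡ true

    IsTail-∷ : ∀ {w rest} → w ∉ rest → IsTail (w ∷ rest) → IsTail rest
    IsTail-∷ {w} {rest} w∉rest tail A y first y∈rest
      with tail A y first (there y∈rest)
    ... | A⊆w∷rest , first′ with firstIn-∷ rest A (λ { refl → w∉rest y∈rest }) first′
    ...   | A[w]≡false , first″ = A⊆rest , first″
      where
      A⊆rest : ∀ x → lookup A x ≡ true → x ∈ rest
      A⊆rest x A[x] with A⊆w∷rest x A[x]
      ... | here refl  = ⊥-elim (Bool.not-¬ A[x] A[w]≡false)
      ... | there x∈rest = x∈rest

    lookup-N[] : ∀ v x → lookup (N[_] G v) x ≡ does (x ≟ v) ∨ adj G v x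
    lookup-N[] v x = trans (lookup-∪ ⁅ v ⁆ (N G v) x) (cong₂ _∨_ (lookup-⁅⁆ v x) (lookup∘tabulate _ x))

    -- As w ∉ Z_π, w comes first in π among N[v] for some v ~ w; then N[v] ∖ {w} lies in the tail, so v forces w.
    force-unforced : ∀ {w rest} → w ∉ rest → IsTail (w ∷ rest) → lookup Z w ≡ false →
                     Forced G Z (Z ∪ listSet rest) → Forced G Z (Z ∪ listSet (w ∷ rest))
    force-unforced {w} {rest} w∉rest tail Z[w] forced =
      subst (Forced G Z) (∪-listSet-∷ Z w rest) (force v w forced v∈S N[v]─S≡⁅w⁆)
      where
      S = Z ∪ listSet rest
      witness = anyIn⇒∃ (N G w) _ (Bool.not-injective (trans (sym (lookup∘tabulate _ w)) Z[w]))
      v = proj₁ witness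

      w~v : adj G w v ≡ true
      w~v = trans (sym (lookup∘tabulate (adj G w) v)) (proj₁ (proj₂ witness))

      N[v]⊆rest : ∀ x → lookup (N[_] G v) x ≡ true → x ≢ w → x ∈ rest
      N[v]⊆rest x N[v][x] x≢w with proj₁ (tail (N[_] G v) w (proj₂ (proj₂ witness)) (here refl)) x N[v][x]
      ... | here x≡w    = ⊥-elim (x≢w x≡w)
      ... | there x∈rest = x∈rest

      adj⇒N[v] : ∀ x → adj G v x ≡ true → lookup (N[_] G v) x ≡ true
      adj⇒N[v] x v~x = trans (lookup-N[] v x) (trans (cong (does (x ≟ v) ∨_) v~x) (Bool.∨-zeroʳ _))

      v∈rest : v ∈ rest
      v∈rest = N[v]⊆rest v (trans (lookup-N[] v v) (cong (_∨ adj G v v) (dec-true (v ≟ v) refl)))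
                          (λ v≡w → Bool.not-¬ (subst (λ y → adj G w y ≡ true) v≡w w~v) (irrefl G w))

      v∈S : v ∈ₛ S
      v∈S = lookup⇒[]= v S (trans (lookup-∪-listSet Z rest v)
                                  (trans (cong (lookup Z v ∨_) (dec-true (v ∈? rest) v∈rest)) (Bool.∨-zeroʳ _)))

      only-w : ∀ x → adj G v x ∧ not (lookup Z x ∨ does (x ∈? rest)) ≡ does (x ≟ w)
      only-w x with x ≟ w
      ... | yes refl rewrite adj-sym G v w | w~v | Z[w] | dec-false (w ∈? rest) w∉rest = refl
      ... | no  x≢w  with adj G v x in v~x
      ...   | false = refl
      ...   | true rewrite dec-true (x ∈? rest) (N[v]⊆rest x (adj⇒N[v] x v~x) x≢w)
                         | Bool.∨-zeroʳ (lookup Z x) = refl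

      N[v]─S≡⁅w⁆ : N G v ─ S ≡ ⁅ w ⁆
      N[v]─S≡⁅w⁆ = lookup-ext λ x → begin
        lookup (N G v ─ S) x
          ≡⟨ lookup-─ (N G v) S x ⟩
        lookup (N G v) x ∧ not (lookup S x)
          ≡⟨ cong₂ (λ a b → a ∧ not b) (lookup∘tabulate _ x) (lookup-∪-listSet Z rest x) ⟩
        adj G v x ∧ not (lookup Z x ∨ does (x ∈? rest))
          ≡⟨ only-w x ⟩
        does (x ≟ w)
          ≡⟨ sym (lookup-⁅⁆ w x) ⟩
        lookup ⁅ w ⁆ x ∎
        where open ≡-Reasoning

    forced-∷ : ∀ {w rest} → w ∉ rest → IsTail (w ∷ rest) →
               Forced G Z (Z ∪ listSet rest) → Forced G Z (Z ∪ listSet (w ∷ rest))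
    forced-∷ {w} {rest} w∉rest tail forced with lookup Z w in Z[w]
    ... | true  = subst (Forced G Z) (∪-listSet-∷-∈ Z rest Z[w]) forced
    ... | false = force-unforced w∉rest tail Z[w] forced

    forced-tail : ∀ t → Unique t → IsTail t → Forced G Z (Z ∪ listSet t)
    forced-tail []         []                 _    =
      subst (Forced G Z) (lookup-ext λ x → sym (trans (lookup-∪-listSet Z [] x) (Bool.∨-identityʳ _))) start
    forced-tail (w ∷ rest) (w≢rest ∷ unique) tail =
      forced-∷ w∉rest tail (forced-tail rest unique (IsTail-∷ w∉rest tail))
      where w∉rest = All¬⇒¬Any w≢rest

    forcingSet-isZeroForcing : Unique π → IsZeroForcingSet G Z
    forcingSet-isZeroForcing π-unique = subst (Forced G Z) Z∪π≡Full
      (forced-tail π π-unique (λ A y first _ → (λ x _ → π-complete x) , first))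
      where
      Z∪π≡Full : Z ∪ listSet π ≡ Full
      Z∪π≡Full = lookup-ext λ x → trans (lookup-∪-listSet Z π x)
        (trans (cong (lookup Z x ∨_) (dec-true (x ∈? π) (π-complete x)))
               (trans (Bool.∨-zeroʳ _) (sym (lookup-replicate x inside))))

module _ {n : ℕ} {π : List (Fin n)} (ord : Ordering (allFin n) π) where

  Ordering-∈ : ∀ u → u ∈ π
  Ordering-∈ u = ∈-resp-↭ (Ordering⇒↭ ord) (∈-allFin u)

  Ordering-Unique : Unique π
  Ordering-Unique = PermutationSetoid.Unique-resp-↭ (setoid (Fin n)) (↭⇒↭ₛ (Ordering⇒↭ ord)) (allFin⁺ n)

  Ordering-isZeroForcing : ∀ G → IsZeroForcingSet G (forcingSet G π)
  Ordering-isZeroForcing G = forcingSet-isZeroForcing G π Ordering-∈ Ordering-Unique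

Σ-orderings-firstIn : ∀ {n} u (S : Subset n) → lookup S u ≡ true →
  Σ-orderings n (allFin n) (λ π → 𝟙 (firstIn π u S)) ≡ fromℕ (n !) * recip ∣ S ∣
Σ-orderings-firstIn {n} u S S[u] = *-recip ∣ S ∣ {{ℕ.>-nonZero (0<∣∣ S u S[u])}} (begin
  fromℕ ∣ S ∣ * W
    ≡⟨ cong (_* W) (sym #S) ⟩
  Σℚ L (λ x → 𝟙 (does (x ≟ u) ∨ lookup S x)) * W
    ≡⟨ Σ-orderings-firstHit n L (λ x → does (x ≟ u)) (lookup S) (length-tabulate _) ⟩
  Σℚ L (λ x → 𝟙 (does (x ≟ u))) * fromℕ (n !)
    ≡⟨ trans (cong (_* fromℕ (n !)) #u) (*-identityˡ _) ⟩
  fromℕ (n !) ∎)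
  where
  open ≡-Reasoning
  L = allFin n
  W = Σ-orderings n L (λ π → 𝟙 (firstIn π u S))

  u-or-S : ∀ x → does (x ≟ u) ∨ lookup S x ≡ lookup S x
  u-or-S x with x ≟ u
  ... | yes refl = sym S[u]
  ... | no  _    = refl

  #S : Σℚ L (λ x → 𝟙 (does (x ≟ u) ∨ lookup S x)) ≡ fromℕ ∣ S ∣
  #S = trans (Σℚ-cong L (λ x → cong 𝟙 (u-or-S x))) (Σℚ-𝟙-lookup S)

  #u : Σℚ L (λ x → 𝟙 (does (x ≟ u))) ≡ 1ℚ
  #u = trans (Σℚ-cong L (λ x → cong 𝟙 (sym (lookup-⁅⁆ u x))))
             (trans (Σℚ-𝟙-lookup ⁅ u ⁆) (trans (cong fromℕ (∣⁅x⁆∣≡1 u)) (+-identityʳ 1ℚ)))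

Σ-orderings-expansion : ∀ {n} (G : Graph n) →
  Σ-orderings n (allFin n) (λ π → Σℚ (allFin n) (expansion G π)) ≡ fromℕ (n !) * bound G
Σ-orderings-expansion {n} G = begin
  Σ-orderings n L (λ π → Σℚ L (expansion G π))
    ≡⟨ Σ-orderings-Σℚ n L L (λ u π → expansion G π u) ⟩
  Σℚ L (λ u → Σ-orderings n L (λ π → expansion G π u))
    ≡⟨ Σℚ-cong L per-vertex ⟩
  Σℚ L (λ u → n! * bound-at u)
    ≡⟨ Σℚ-*ˡ L n! bound-at ⟩
  n! * bound G ∎
  where
  open ≡-Reasoning
  L = allFin n
  n! = fromℕ (n !)

  1/∣covered∣ : Fin n → Subset n → ℚ
  1/∣covered∣ u I = recip ∣ covered G u I ∣

  bound-at : Fin n → ℚ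
  bound-at u = Σℚ (upTo (suc (deg G u))) λ i → sign i * Σℚ (binom (N G u) i) (1/∣covered∣ u)

  term : Fin n → ℕ → List (Fin n) → ℚ
  term u i π = sign i * Σℚ (binom (N G u) i) (λ I → 𝟙 (firstIn π u (covered G u I)))

  per-size : ∀ u i → Σ-orderings n L (term u i) ≡ n! * (sign i * Σℚ (binom (N G u) i) (1/∣covered∣ u))
  per-size u i = begin
    Σ-orderings n L (term u i)
      ≡⟨ Σ-orderings-*ˡ n L (sign i) _ ⟩
    sign i * Σ-orderings n L (λ π → Σℚ (binom (N G u) i) (λ I → 𝟙 (firstIn π u (covered G u I))))
      ≡⟨ cong (sign i *_) (Σ-orderings-Σℚ n L (binom (N G u) i) _) ⟩
    sign i * Σℚ (binom (N G u) i) (λ I → Σ-orderings n L (λ π → 𝟙 (firstIn π u (covered G u I))))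
      ≡⟨ cong (sign i *_) (Σℚ-cong (binom (N G u) i) λ I →
           Σ-orderings-firstIn u (covered G u I) (u∈covered G u I)) ⟩
    sign i * Σℚ (binom (N G u) i) (λ I → n! * 1/∣covered∣ u I)
      ≡⟨ cong (sign i *_) (Σℚ-*ˡ (binom (N G u) i) n! (1/∣covered∣ u)) ⟩
    sign i * (n! * Σℚ (binom (N G u) i) (1/∣covered∣ u))
      ≡⟨ *-left-comm (sign i) n! _ ⟩
    n! * (sign i * Σℚ (binom (N G u) i) (1/∣covered∣ u)) ∎
    where *-left-comm : ∀ a b c → a * (b * c) ≡ b * (a * c)
          *-left-comm = solve-∀ ℚ-ring

  per-vertex : ∀ u → Σ-orderings n L (λ π → expansion G π u) ≡ n! * bound-at u
  per-vertex u = begin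
    Σ-orderings n L (λ π → expansion G π u)
      ≡⟨ Σ-orderings-Σℚ n L (upTo (suc (deg G u))) (λ i π → term u i π) ⟩
    Σℚ (upTo (suc (deg G u))) (λ i → Σ-orderings n L (term u i))
      ≡⟨ Σℚ-cong (upTo (suc (deg G u))) (per-size u) ⟩
    Σℚ (upTo (suc (deg G u))) (λ i → n! * (sign i * Σℚ (binom (N G u) i) (1/∣covered∣ u)))
      ≡⟨ Σℚ-*ˡ (upTo (suc (deg G u))) n! _ ⟩
    n! * bound-at u ∎

forcingSet-size : ∀ {n} (G : Graph n) {π} → Ordering (allFin n) π →
                  fromℕ ∣ forcingSet G π ∣ ≡ Σℚ (allFin n) (expansion G π)
forcingSet-size G {π} ord = trans (sym (Σℚ-𝟙-lookup (forcingSet G π)))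
                              (Σℚ-cong (allFin _) (λ u → 𝟙-forcingSet G u (Ordering-∈ ord u)))

theorem3 : (n : ℕ) (G : Graph n) (k : ℕ) → IsZeroForcingNumber G k → ℕ→ℚ k ≤ bound G
theorem3 n G k (_ , minimal) = *-cancelˡ-≤-pos n! {{fromℕ-pos (n !) {{n ℕ.!≢0}}}} (begin
  n! * ℕ→ℚ k
    ≤⟨ Σ-orderings-lower n (allFin n) (ℕ→ℚ k) _ (length-tabulate _) k≤ ⟩
  Σ-orderings n (allFin n) (λ π → Σℚ (allFin n) (expansion G π))
    ≡⟨ Σ-orderings-expansion G ⟩
  n! * bound G ∎)
  where
  open ≤-Reasoning
  n! = fromℕ (n !)
  k≤ : ∀ π → Ordering (allFin n) π → ℕ→ℚ k ≤ Σℚ (allFin n) (expansion G π)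
  k≤ π ord = begin
    ℕ→ℚ k                              ≡⟨ sym (fromℕ≡ℕ→ℚ k) ⟩
    fromℕ k                            ≤⟨ fromℕ-mono (minimal _ (Ordering-isZeroForcing ord G)) ⟩
    fromℕ ∣ forcingSet G π ∣            ≡⟨ forcingSet-size G ord ⟩
    Σℚ (allFin n) (expansion G π)      ∎
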